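{- Let $q$ be even, let $\mathcal{O}$ be an ovoid of $\mathsf{Q}^+(9,q)$, let $P_1,P_2\in\mathcal{O}$ be distinct, and let $\mathsf{Q}^+_7=P_1^\perp\cap P_2^\perp\cap\mathsf{Q}^+(9,q)$ (a quadric isomorphic to $\mathsf{Q}^+(7,q)$). Let $\sigma_1$ be a generator (solid) of $\mathsf{Q}^+_7$, let $\mathsf{Q}^-_3$ be the point set of an elliptic quadric $\mathsf{Q}^-(3,q)$ embedded in $\sigma_1$, and let $\Pi$ be the set of the $q^2+1$ tangent planes (in $\sigma_1$) of $\mathsf{Q}^-_3$ at its points. Let $\sigma_2$ be a generator of $\mathsf{Q}^+_7$ disjoint from $\sigma_1$; for each $\pi\in\Pi$, $\pi^\perp$ meets $\sigma_2$ in a point. Define the set of $q^2+1$ lines $\mathcal{L}=\{\langle \pi^\perp\cap\sigma_2,\ \pi\cap\mathsf{Q}^-_3\rangle:\pi\in\Pi\}$. Let $l_1,l_2\in\mathcal{L}$ with $l_1\ne l_2$, and let $P\in l_1$ and $Q\in l_2$ be collinear points with $P,Q\notin\sigma_1$. Then $P\notin l_2^\perp$.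
   Context: $\mathsf{Q}^+(9,q)$ is the hyperbolic quadric of $\mathrm{PG}(9,q)$ (polar space of a non-degenerate quadratic form of Witt index $5$ on $V(10,q)$), with generators the totally singular $4$-spaces; $\perp$ denotes the polarity of the associated (alternating) bilinear form, and for a set $A$ of points $A^\perp=\bigcap_{X\in A}X^\perp$. Two points are collinear if the line joining them is totally singular. An ovoid is a set of points meeting every generator in exactly one point. -}

module Defs where

open import Level using (0ℓ)
open import Data.Nat using (ℕ)
import Data.Nat as Nat
open import Data.Fin using (Fin; zero; suc; #_)
open import Data.Product using (Σ; ∃; _×_; _,_)
open import Relation.Nullary using (¬_)
open import Relation.Binary.PropositionalEquality using (_≡_)
open import Algebra.Bundles using (CommutativeRing)

-- A finite field with exactly q elements (stdlib has no Field bundle):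
-- a commutative ring with 1 ≉ 0 in which every nonzero element is
-- invertible, together with a bijection Fin q ≅ Carrier (up to ≈).
record FiniteField (q : ℕ) : Set₁ where
  field
    cring : CommutativeRing 0ℓ 0ℓ
  open CommutativeRing cring public
  field
    1≉0       : ¬ (1# ≈ 0#)
    inverse   : ∀ x → ¬ (x ≈ 0#) → ∃ λ y → x * y ≈ 1#
    enum      : Fin q → Carrier
    enum-surj : ∀ x → ∃ λ i → enum i ≈ x
    enum-inj  : ∀ i j → enum i ≈ enum j → i ≡ j

module Geometry {q : ℕ} (F : FiniteField q) where
  open FiniteField F hiding (zero)

  sumF : ∀ {n} → (Fin n → Carrier) → Carrier
  sumF {Nat.zero}  f = 0#
  sumF {Nat.suc n} f = f zero + sumF (λ i → f (suc i))

  V : ℕ → Set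
  V n = Fin n → Carrier

  _≈ᵥ_ : ∀ {n} → V n → V n → Set
  u ≈ᵥ v = ∀ i → u i ≈ v i

  0ᵥ : ∀ {n} → V n
  0ᵥ = λ _ → 0#

  _+ᵥ_ : ∀ {n} → V n → V n → V n
  u +ᵥ v = λ i → u i + v i

  _·ᵥ_ : ∀ {n} → Carrier → V n → V n
  a ·ᵥ v = λ i → a * v i

  lin : ∀ {n k} → V k → (Fin k → V n) → V n
  lin c b = λ j → sumF (λ i → c i * b i j)

  NonzeroV : ∀ {n} → V n → Set
  NonzeroV v = ¬ (v ≈ᵥ 0ᵥ)

  InSpan : ∀ {n k} → (Fin k → V n) → V n → Set
  InSpan b v = ∃ λ c → v ≈ᵥ lin c b

  LinIndep : ∀ {n k} → (Fin k → V n) → Set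
  LinIndep b = ∀ c → lin c b ≈ᵥ 0ᵥ → ∀ i → c i ≈ 0#

  -- u and v represent the same projective point
  Proportional : ∀ {n} → V n → V n → Set
  Proportional u v = ∃ λ a → ¬ (a ≈ 0#) × (u ≈ᵥ (a ·ᵥ v))

  pair : ∀ {n} → V n → V n → Fin 2 → V n
  pair u v zero    = u
  pair u v (suc _) = v

  -- The hyperbolic quadric Q⁺(9,q): standard form of Witt index 5
  -- Q(x) = x0 x1 + x2 x3 + x4 x5 + x6 x7 + x8 x9 on V(10,q).
  ev od : Fin 5 → Fin 10
  ev zero                             = # 0
  ev (suc zero)                       = # 2
  ev (suc (suc zero))                 = # 4
  ev (suc (suc (suc zero)))           = # 6
  ev (suc (suc (suc (suc zero))))     = # 8
  od zero                             = # 1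
  od (suc zero)                       = # 3
  od (suc (suc zero))                 = # 5
  od (suc (suc (suc zero)))           = # 7
  od (suc (suc (suc (suc zero))))     = # 9

  Qf : V 10 → Carrier
  Qf x = sumF (λ i → x (ev i) * x (od i))

  Bf : V 10 → V 10 → Carrier
  Bf x y = Qf (x +ᵥ y) - Qf x - Qf y

  -- points of PG(9,q): nonzero vectors (up to Proportional)
  -- the subspace spanned by b is totally singular
  TotSingular : ∀ {k} → (Fin k → V 10) → Set
  TotSingular b = ∀ c → Qf (lin c b) ≈ 0#

  -- generators of Q⁺(9,q): totally singular 4-spaces (5-dim subspaces),
  -- given by a basis
  Generator : (Fin 5 → V 10) → Set
  Generator g = LinIndep g × TotSingular g

  IsQuadricPointSet : (V 10 → Set) → Set
  IsQuadricPointSet O =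
    (∀ u v → Proportional u v → O v → O u) ×
    (∀ v → O v → NonzeroV v × Qf v ≈ 0#)

  Ovoid : (V 10 → Set) → Set
  Ovoid O = IsQuadricPointSet O ×
    (∀ g → Generator g →
       (∃ λ v → O v × InSpan g v) ×
       (∀ u v → O u → O v → InSpan g u → InSpan g v → Proportional u v))

  Collinear : V 10 → V 10 → Set
  Collinear u v = ¬ Proportional u v × TotSingular (pair u v)

  SolidOfQ7 : V 10 → V 10 → (Fin 4 → V 10) → Set
  SolidOfQ7 P1 P2 s = LinIndep s × TotSingular s ×
    (∀ c → (Bf P1 (lin c s) ≈ 0#) × (Bf P2 (lin c s) ≈ 0#))

  -- quadratic forms on the 4-dim coordinate space of a solid:
  -- Qa(c) = Σ_{i,j} a_ij c_i c_j
  QForm4 : (Fin 4 → Fin 4 → Carrier) → V 4 → Carrier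
  QForm4 a c = sumF (λ i → sumF (λ j → a i j * c i * c j))

  BForm4 : (Fin 4 → Fin 4 → Carrier) → V 4 → V 4 → Carrier
  BForm4 a c d = QForm4 a (c +ᵥ d) - QForm4 a c - QForm4 a d

  -- elliptic quadric Q⁻(3,q): non-degenerate, Witt index 1
  -- (has a singular point, but no totally singular line)
  Elliptic : (Fin 4 → Fin 4 → Carrier) → Set
  Elliptic a =
    (∀ c → (∀ d → BForm4 a c d ≈ 0#) → c ≈ᵥ 0ᵥ) ×
    (∃ λ c → NonzeroV c × QForm4 a c ≈ 0#) ×
    (∀ (b : Fin 2 → V 4) → LinIndep b → ¬ (∀ e → QForm4 a (lin e b) ≈ 0#))

  SameSpan : ∀ {k} → (Fin k → V 10) → (Fin k → V 10) → Set
  SameSpan b b' = ∀ v → (InSpan b v → InSpan b' v) × (InSpan b' v → InSpan b v)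

module Submission where

open import Defs
open import Data.Nat using (ℕ)
open import Data.Nat.Divisibility using (_∣_)
open import Data.Fin using (Fin)
open import Relation.Nullary using (¬_)

import Data.Nat as ℕ
open import Data.Fin as Fin using (zero; suc)
open import Data.Vec.Functional using ([]; _∷_; head; tail)
open import Data.Product using (∃; _×_; _,_; proj₁; proj₂)
open import Data.Empty using (⊥-elim)
open import Relation.Nullary using (Dec; yes; no)
import Relation.Binary.PropositionalEquality as ≡

-- Write X₁ = lin x₁ σ₁ and X₂ = lin x₂ σ₁ for the points of the
-- elliptic quadric and R₁, R₂ ∈ σ₂ for the poles of their tangent planes.
-- (1) A solid σ of Q⁺₇ = P₁^⊥ ∩ P₂^⊥ ∩ Q⁺(9,q) lies in no generator of
--     Q⁺(9,q): an ovoid point perpendicular to a generator lies in it, so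
--     such a generator would contain both ovoid points P₁ and P₂.  Hence no
--     nonzero point of σ₂ is perpendicular to all of σ₁.
-- (2) The functional d ↦ B(lin d σ₁, R) of a pole R vanishes on the kernel
--     of d ↦ B₄(x, d), so it is a multiple of it; by (1) the multiple is
--     nonzero, and two poles of the same tangent plane are proportional.
-- (3) If P ∈ l₁ \ σ₁ were perpendicular to l₂, then R₁ ⟂ X₂ (σ₁ is totally
--     singular), so by (2) x₂ lies on the tangent plane at x₁.  An elliptic
--     quadric has no two distinct conjugate points, so x₁ ∝ x₂; then R₁ ∝ R₂
--     by (2) and l₁ = l₂, a contradiction.

module OvoidGeometry {q : ℕ} (F : FiniteField q) where
  open FiniteField F hiding (zero)
  open Geometry F
  open import Algebra.Properties.Ring ring
    using (-‿distribˡ-*; -‿+-comm; //-rightDividesʳ; x≈y⇒x∙y⁻¹≈ε; x∙y⁻¹≈ε⇒x≈y; -0#≈0#; -1*x≈-x)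
  open import Relation.Binary.Reasoning.Setoid setoid
  open import Algebra.Solver.Ring.NaturalCoefficients.Default commutativeSemiring
    using (solve; _:=_; _:+_; _:*_)

  -- Equality of field elements is decidable, by comparing enumeration indices.
  _≟_ : ∀ x y → Dec (x ≈ y)
  x ≟ y with enum-surj x | enum-surj y
  ... | i , eᵢ | j , eⱼ with i Fin.≟ j
  ...   | yes ≡.refl = yes (trans (sym eᵢ) eⱼ)
  ...   | no i≢j = no (λ x≈y → i≢j (enum-inj i j (trans eᵢ (trans x≈y (sym eⱼ)))))

  stable : ∀ {x y} → ¬ ¬ (x ≈ y) → x ≈ y
  stable {x} {y} ¬¬x≈y with x ≟ y
  ... | yes x≈y = x≈y
  ... | no x≉y = ⊥-elim (¬¬x≈y x≉y)

  inv : ∀ x → x ≉ 0# → Carrier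
  inv x x≉0 = proj₁ (inverse x x≉0)

  inv-r : ∀ x (x≉0 : x ≉ 0#) → x * inv x x≉0 ≈ 1#
  inv-r x x≉0 = proj₂ (inverse x x≉0)

  divideˡ : ∀ {x y z} (x≉0 : x ≉ 0#) → x * y ≈ z → y ≈ inv x x≉0 * z
  divideˡ {x} {y} {z} x≉0 xy≈z = begin
    y                        ≈⟨ *-identityˡ y ⟨
    1# * y                   ≈⟨ *-congʳ (inv-r x x≉0) ⟨
    (x * inv x x≉0) * y      ≈⟨ reorder x (inv x x≉0) y ⟩
    inv x x≉0 * (x * y)      ≈⟨ *-congˡ xy≈z ⟩
    inv x x≉0 * z            ∎
    where
    reorder : ∀ a b c → (a * b) * c ≈ b * (a * c)
    reorder = solve 3 (λ a b c → (a :* b) :* c := b :* (a :* c)) refl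

  cancelˡ : ∀ {x y} → x ≉ 0# → x * y ≈ 0# → y ≈ 0#
  cancelˡ x≉0 xy≈0 = trans (divideˡ x≉0 xy≈0) (zeroʳ _)

  inv-nonzero : ∀ x (x≉0 : x ≉ 0#) → inv x x≉0 ≉ 0#
  inv-nonzero x x≉0 inv≈0 = 1≉0 (trans (sym (inv-r x x≉0)) (trans (*-congˡ inv≈0) (zeroʳ x)))

  *-nonzero : ∀ {x y} → x ≉ 0# → y ≉ 0# → x * y ≉ 0#
  *-nonzero x≉0 y≉0 xy≈0 = y≉0 (cancelˡ x≉0 xy≈0)

  divide-cancel : ∀ x y (y≉0 : y ≉ 0#) → (x * inv y y≉0) * y ≈ x
  divide-cancel x y y≉0 = begin
    (x * inv y y≉0) * y    ≈⟨ reorder x (inv y y≉0) y ⟩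
    x * (y * inv y y≉0)    ≈⟨ *-congˡ (inv-r y y≉0) ⟩
    x * 1#                 ≈⟨ *-identityʳ x ⟩
    x                      ∎
    where
    reorder : ∀ a b c → (a * b) * c ≈ a * (c * b)
    reorder = solve 3 (λ a b c → (a :* b) :* c := a :* (c :* b)) refl

  balance : ∀ {x} a y → x + (- a) * y ≈ 0# → x ≈ a * y
  balance {x} a y e = x∙y⁻¹≈ε⇒x≈y x (a * y) (trans (+-congˡ (-‿distribˡ-* a y)) e)

  balance⁻¹ : ∀ {x} a y → x ≈ a * y → x + (- a) * y ≈ 0#
  balance⁻¹ {x} a y e = trans (+-congˡ (sym (-‿distribˡ-* a y))) (x≈y⇒x∙y⁻¹≈ε e)

  cancel-sum : ∀ a b k → ((a + b) + k) - a - b ≈ k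
  cancel-sum a b k = begin
    ((a + b) + k) - a - b            ≈⟨ regroup a b k (- a) (- b) ⟩
    k + ((a + b) + (- a - b))        ≈⟨ +-congˡ (+-congˡ (-‿+-comm a b)) ⟩
    k + ((a + b) - (a + b))          ≈⟨ +-congˡ (-‿inverseʳ (a + b)) ⟩
    k + 0#                           ≈⟨ +-identityʳ k ⟩
    k                                ∎
    where
    regroup : ∀ a b k na nb → ((a + b) + k) + na + nb ≈ k + ((a + b) + (na + nb))
    regroup = solve 5 (λ a b k na nb →
      (((a :+ b) :+ k) :+ na) :+ nb := k :+ ((a :+ b) :+ (na :+ nb))) refl

  zero-minus : (0# - 0#) - 0# ≈ 0#
  zero-minus = trans (+-cong (-‿inverseʳ 0#) -0#≈0#) (+-identityʳ 0#)

  sumF-cong : ∀ {n} {f g : Fin n → Carrier} → (∀ i → f i ≈ g i) → sumF f ≈ sumF g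
  sumF-cong {ℕ.zero}  e = refl
  sumF-cong {ℕ.suc n} e = +-cong (e zero) (sumF-cong (λ i → e (suc i)))

  sumF-+ : ∀ {n} (f g : Fin n → Carrier) → sumF (λ i → f i + g i) ≈ sumF f + sumF g
  sumF-+ {ℕ.zero}  f g = sym (+-identityʳ 0#)
  sumF-+ {ℕ.suc n} f g =
    trans (+-congˡ (sumF-+ (tail f) (tail g))) (interchange (f zero) (g zero) _ _)
    where
    interchange : ∀ a b c d → (a + b) + (c + d) ≈ (a + c) + (b + d)
    interchange = solve 4 (λ a b c d → (a :+ b) :+ (c :+ d) := (a :+ c) :+ (b :+ d)) refl

  sumF-* : ∀ {n} a (f : Fin n → Carrier) → sumF (λ i → a * f i) ≈ a * sumF f
  sumF-* {ℕ.zero}  a f = sym (zeroʳ a)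
  sumF-* {ℕ.suc n} a f = trans (+-congˡ (sumF-* a (tail f))) (sym (distribˡ a _ _))

  sumF-zero : ∀ {n} {f : Fin n → Carrier} → (∀ i → f i ≈ 0#) → sumF f ≈ 0#
  sumF-zero {ℕ.zero}  e = refl
  sumF-zero {ℕ.suc n} e = trans (+-cong (e zero) (sumF-zero (λ i → e (suc i)))) (+-identityʳ 0#)

  ≈ᵥ-sym : ∀ {n} {u v : V n} → u ≈ᵥ v → v ≈ᵥ u
  ≈ᵥ-sym e i = sym (e i)

  ≈ᵥ-trans : ∀ {n} {u v w : V n} → u ≈ᵥ v → v ≈ᵥ w → u ≈ᵥ w
  ≈ᵥ-trans e f i = trans (e i) (f i)

  lin-cong : ∀ {n k} {c d : V k} (b : Fin k → V n) → c ≈ᵥ d → lin c b ≈ᵥ lin d b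
  lin-cong b e j = sumF-cong (λ i → *-congʳ (e i))

  lin-+ : ∀ {n k} (c d : V k) (b : Fin k → V n) → lin (c +ᵥ d) b ≈ᵥ (lin c b +ᵥ lin d b)
  lin-+ c d b j = trans (sumF-cong (λ i → distribʳ (b i j) (c i) (d i)))
                        (sumF-+ (λ i → c i * b i j) (λ i → d i * b i j))

  lin-· : ∀ {n k} a (c : V k) (b : Fin k → V n) → lin (a ·ᵥ c) b ≈ᵥ (a ·ᵥ lin c b)
  lin-· a c b j = trans (sumF-cong (λ i → *-assoc a (c i) (b i j))) (sumF-* a (λ i → c i * b i j))

  lin-0 : ∀ {n k} (b : Fin k → V n) → lin 0ᵥ b ≈ᵥ 0ᵥ
  lin-0 b j = sumF-zero (λ i → zeroˡ (b i j))

  span-cong : ∀ {n k} {b : Fin k → V n} {u v} → u ≈ᵥ v → InSpan b v → InSpan b u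
  span-cong u≈v (c , v≈) = c , ≈ᵥ-trans u≈v v≈

  span-zero : ∀ {n k} {b : Fin k → V n} → InSpan b 0ᵥ
  span-zero {b = b} = 0ᵥ , ≈ᵥ-sym (lin-0 b)

  span-+ : ∀ {n k} {b : Fin k → V n} {u v} → InSpan b u → InSpan b v → InSpan b (u +ᵥ v)
  span-+ {b = b} (c , u≈) (d , v≈) = (c +ᵥ d) , λ j → trans (+-cong (u≈ j) (v≈ j)) (sym (lin-+ c d b j))

  span-· : ∀ {n k} {b : Fin k → V n} {u} a → InSpan b u → InSpan b (a ·ᵥ u)
  span-· {b = b} a (c , u≈) = (a ·ᵥ c) , λ j → trans (*-congˡ (u≈ j)) (sym (lin-· a c b j))

  span-gen : ∀ {n k} (b : Fin k → V n) i → InSpan b (b i)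
  span-gen b zero = (1# ∷ 0ᵥ) , λ j →
    sym (trans (+-cong (*-identityˡ (b zero j)) (lin-0 (tail b) j)) (+-identityʳ _))
  span-gen b (suc i) with span-gen (tail b) i
  ... | c , bᵢ≈ = (0# ∷ c) , λ j → trans (bᵢ≈ j) (sym (trans (+-congʳ (zeroˡ _)) (+-identityˡ _)))

  span-sub : ∀ {n k m} {b : Fin k → V n} {b' : Fin m → V n} →
             (∀ i → InSpan b' (b i)) → ∀ {v} → InSpan b v → InSpan b' v
  span-sub {k = ℕ.zero}  h (c , v≈) = span-cong v≈ span-zero
  span-sub {k = ℕ.suc k} h (c , v≈) =
    span-cong v≈ (span-+ (span-· (head c) (h zero)) (span-sub (λ i → h (suc i)) (tail c , λ _ → refl)))

  span-cancel : ∀ {n k} {b : Fin k → V n} {c u w} → c ≉ 0# →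
                InSpan b ((c ·ᵥ u) +ᵥ w) → InSpan b w → InSpan b u
  span-cancel {c = c} {u} {w} c≉0 hM hw =
    span-cong u≈ (span-· (inv c c≉0) (span-+ hM (span-· (- 1#) hw)))
    where
    u≈ : u ≈ᵥ (inv c c≉0 ·ᵥ (((c ·ᵥ u) +ᵥ w) +ᵥ ((- 1#) ·ᵥ w)))
    u≈ j = divideˡ c≉0 (sym (trans (+-congˡ (-1*x≈-x (w j))) (//-rightDividesʳ (w j) (c * u j))))

  indep-cons : ∀ {n k} {b : Fin k → V n} {v} → LinIndep b → ¬ InSpan b v → LinIndep (v ∷ b)
  indep-cons {b = b} {v} indb v∉b c lin≈0 = λ { zero → c₀≈0 ; (suc i) → indb (tail c) L≈0 i }
    where
    L = lin (tail c) b
    c₀≈0 : head c ≈ 0#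
    c₀≈0 = stable (λ c₀≉0 → v∉b (span-cancel c₀≉0 (span-cong lin≈0 span-zero) (tail c , λ _ → refl)))
    L≈0 : L ≈ᵥ 0ᵥ
    L≈0 j = trans (sym (trans (+-congʳ (trans (*-congʳ c₀≈0) (zeroˡ _))) (+-identityˡ _))) (lin≈0 j)

  indep-tail : ∀ {n k} {b : Fin (ℕ.suc k) → V n} → LinIndep b → LinIndep (tail b)
  indep-tail indb c lin≈0 i =
    indb (0# ∷ c) (λ j → trans (trans (+-congʳ (zeroˡ _)) (+-identityˡ _)) (lin≈0 j)) (suc i)

  -- Exchange: if σ is independent and R ∉ ⟨σ⟩, every v ∈ ⟨R, σ⟩ lies in the
  -- span of an independent family τ ⊆ ⟨R, σ⟩ of the same size as σ
  -- (τ = σ when v ∈ ⟨σ⟩, otherwise σ with its first vector replaced by v).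
  hyperplaneThrough : ∀ {n k} {R : V n} {σ : Fin (ℕ.suc k) → V n} {v} →
    LinIndep σ → ¬ InSpan σ R → InSpan (R ∷ σ) v →
    ∃ λ (τ : Fin (ℕ.suc k) → V n) → LinIndep τ × (∀ i → InSpan (R ∷ σ) (τ i)) × InSpan τ v
  hyperplaneThrough {R = R} {σ} {v} indσ R∉σ (c , v≈) with head c ≟ 0#
  ... | yes c₀≈0 =
    σ , indσ , (λ i → span-gen (R ∷ σ) (suc i)) ,
    (tail c , λ j → trans (v≈ j) (trans (+-congʳ (trans (*-congʳ c₀≈0) (zeroˡ _))) (+-identityˡ _)))
  ... | no c₀≉0 =
    (v ∷ tail σ) , indep-cons {b = tail σ} (indep-tail {b = σ} indσ) v∉ , τ⊆ , span-gen (v ∷ tail σ) zero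
    where
    tailσ⊆σ : ∀ i → InSpan σ (tail σ i)
    tailσ⊆σ i = span-gen σ (suc i)
    v∉ : ¬ InSpan (tail σ) v
    v∉ h = R∉σ (span-cancel {b = σ} c₀≉0
      (span-cong {b = σ} (≈ᵥ-sym v≈) (span-sub {b = tail σ} {b' = σ} tailσ⊆σ h)) (tail c , λ _ → refl))
    τ⊆ : ∀ i → InSpan (R ∷ σ) ((v ∷ tail σ) i)
    τ⊆ zero    = c , v≈
    τ⊆ (suc i) = span-gen (R ∷ σ) (suc (suc i))

  indep-pair : ∀ {n} {x y : V n} → NonzeroV x → NonzeroV y → ¬ Proportional x y →
               LinIndep (x ∷ y ∷ [])
  indep-pair {x = x} {y} x≠0 y≠0 x≁y = indep-cons {b = y ∷ []} (indep-cons {b = []} (λ _ _ ()) y∉) x∉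
    where
    y∉ : ¬ InSpan [] y
    y∉ (_ , y≈0) = y≠0 y≈0
    x∉ : ¬ InSpan (y ∷ []) x
    x∉ (c , x≈) with head c ≟ 0#
    ... | yes c₀≈0 = x≠0 (λ j → trans (x≈ j) (trans (+-identityʳ _) (trans (*-congʳ c₀≈0) (zeroˡ _))))
    ... | no c₀≉0  = x≁y (head c , c₀≉0 , λ j → trans (x≈ j) (+-identityʳ _))

  proportional-sym : ∀ {n} {u v : V n} → Proportional u v → Proportional v u
  proportional-sym (a , a≉0 , u≈) = inv a a≉0 , inv-nonzero a a≉0 , λ j → divideˡ a≉0 (sym (u≈ j))

  proportional-span : ∀ {n k} {b : Fin k → V n} {u v} → Proportional u v → InSpan b v → InSpan b u
  proportional-span (a , _ , u≈) hv = span-cong u≈ (span-· a hv)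

  proportional-lin : ∀ {n k} {x y : V k} (b : Fin k → V n) →
                     Proportional x y → Proportional (lin x b) (lin y b)
  proportional-lin b (a , a≉0 , x≈) = a , a≉0 , ≈ᵥ-trans (lin-cong b x≈) (lin-· a _ b)

  sameSpan-pair : ∀ {u u' v v'} → Proportional u u' → Proportional v v' →
                  SameSpan (pair u v) (pair u' v')
  sameSpan-pair {u} {u'} {v} {v'} u∝u' v∝v' w =
    span-sub {b = pair u v} {b' = pair u' v'} forward ,
    span-sub {b = pair u' v'} {b' = pair u v} backward
    where
    forward : ∀ i → InSpan (pair u' v') (pair u v i)
    forward zero    = proportional-span {b = pair u' v'} u∝u' (span-gen (pair u' v') zero)
    forward (suc _) = proportional-span {b = pair u' v'} v∝v' (span-gen (pair u' v') (suc zero))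
    backward : ∀ i → InSpan (pair u v) (pair u' v' i)
    backward zero    =
      proportional-span {b = pair u v} (proportional-sym u∝u') (span-gen (pair u v) zero)
    backward (suc _) =
      proportional-span {b = pair u v} (proportional-sym v∝v') (span-gen (pair u v) (suc zero))

  Polar : ∀ {n} → (V n → Carrier) → V n → V n → Carrier
  Polar Q u v = Q (u +ᵥ v) - Q u - Q v

  record IsQuadratic {n} (Q : V n → Carrier) (B : V n → V n → Carrier) : Set where
    field
      Q-cong   : ∀ {u v} → u ≈ᵥ v → Q u ≈ Q v
      Q-scale  : ∀ a u → Q (a ·ᵥ u) ≈ (a * a) * Q u
      Q-expand : ∀ u v → Q (u +ᵥ v) ≈ (Q u + Q v) + B u v
      B-addˡ   : ∀ u v w → B (u +ᵥ v) w ≈ B u w + B v w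
      B-scaleˡ : ∀ a u w → B (a ·ᵥ u) w ≈ a * B u w

  product-isQuadratic : ∀ {n} (k l : Fin n) →
    IsQuadratic (λ x → x k * x l) (λ u v → u k * v l + v k * u l)
  product-isQuadratic k l = record
    { Q-cong   = λ e → *-cong (e k) (e l)
    ; Q-scale  = λ a u → scale a (u k) (u l)
    ; Q-expand = λ u v → expand (u k) (v k) (u l) (v l)
    ; B-addˡ   = λ u v w → add (u k) (v k) (w l) (w k) (u l) (v l)
    ; B-scaleˡ = λ a u w → scaleˡ a (u k) (w l) (w k) (u l)
    }
    where
    scale : ∀ a x y → (a * x) * (a * y) ≈ (a * a) * (x * y)
    scale = solve 3 (λ a x y → (a :* x) :* (a :* y) := (a :* a) :* (x :* y)) refl
    expand : ∀ x y z w → (x + y) * (z + w) ≈ (x * z + y * w) + (x * w + y * z)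
    expand = solve 4 (λ x y z w → (x :+ y) :* (z :+ w) := (x :* z :+ y :* w) :+ (x :* w :+ y :* z)) refl
    add : ∀ x y z w x' y' → (x + y) * z + w * (x' + y') ≈ (x * z + w * x') + (y * z + w * y')
    add = solve 6 (λ x y z w x' y' →
      (x :+ y) :* z :+ w :* (x' :+ y') := (x :* z :+ w :* x') :+ (y :* z :+ w :* y')) refl
    scaleˡ : ∀ a x z w x' → (a * x) * z + w * (a * x') ≈ a * (x * z + w * x')
    scaleˡ = solve 5 (λ a x z w x' → (a :* x) :* z :+ w :* (a :* x') := a :* (x :* z :+ w :* x')) refl

  weighted-isQuadratic : ∀ {n} A (k l : Fin n) →
    IsQuadratic (λ x → A * x k * x l) (λ u v → A * (u k * v l + v k * u l))
  weighted-isQuadratic A k l = record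
    { Q-cong   = λ e → *-cong (*-congˡ (e k)) (e l)
    ; Q-scale  = λ a u → scale A a (u k) (u l)
    ; Q-expand = λ u v → expand A (u k) (v k) (u l) (v l)
    ; B-addˡ   = λ u v w → add A (u k) (v k) (w l) (w k) (u l) (v l)
    ; B-scaleˡ = λ a u w → scaleˡ A a (u k) (w l) (w k) (u l)
    }
    where
    scale : ∀ A a x y → (A * (a * x)) * (a * y) ≈ (a * a) * ((A * x) * y)
    scale = solve 4 (λ A a x y → (A :* (a :* x)) :* (a :* y) := (a :* a) :* ((A :* x) :* y)) refl
    expand : ∀ A x y z w → (A * (x + y)) * (z + w) ≈ ((A * x) * z + (A * y) * w) + A * (x * w + y * z)
    expand = solve 5 (λ A x y z w →
      (A :* (x :+ y)) :* (z :+ w) := ((A :* x) :* z :+ (A :* y) :* w) :+ A :* (x :* w :+ y :* z)) refl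
    add : ∀ A x y z w x' y' →
          A * ((x + y) * z + w * (x' + y')) ≈ A * (x * z + w * x') + A * (y * z + w * y')
    add = solve 7 (λ A x y z w x' y' →
      A :* ((x :+ y) :* z :+ w :* (x' :+ y'))
        := A :* (x :* z :+ w :* x') :+ A :* (y :* z :+ w :* y')) refl
    scaleˡ : ∀ A a x z w x' → A * ((a * x) * z + w * (a * x')) ≈ a * (A * (x * z + w * x'))
    scaleˡ = solve 6 (λ A a x z w x' →
      A :* ((a :* x) :* z :+ w :* (a :* x')) := a :* (A :* (x :* z :+ w :* x'))) refl

  sum-isQuadratic : ∀ {n m} {Q : Fin m → V n → Carrier} {B : Fin m → V n → V n → Carrier} →
    (∀ i → IsQuadratic (Q i) (B i)) →
    IsQuadratic (λ x → sumF (λ i → Q i x)) (λ u v → sumF (λ i → B i u v))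
  sum-isQuadratic {Q = Q} {B} isQ = record
    { Q-cong   = λ e → sumF-cong (λ i → Q-cong (isQ i) e)
    ; Q-scale  = λ a u → trans (sumF-cong (λ i → Q-scale (isQ i) a u)) (sumF-* (a * a) (λ i → Q i u))
    ; Q-expand = λ u v → trans (sumF-cong (λ i → Q-expand (isQ i) u v))
                               (trans (sumF-+ (λ i → Q i u + Q i v) (λ i → B i u v))
                                      (+-congʳ (sumF-+ (λ i → Q i u) (λ i → Q i v))))
    ; B-addˡ   = λ u v w → trans (sumF-cong (λ i → B-addˡ (isQ i) u v w))
                                 (sumF-+ (λ i → B i u w) (λ i → B i v w))
    ; B-scaleˡ = λ a u w → trans (sumF-cong (λ i → B-scaleˡ (isQ i) a u w)) (sumF-* a (λ i → B i u w))
    }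
    where open IsQuadratic

  Qf-isQuadratic : IsQuadratic Qf (λ u v → sumF (λ i → u (ev i) * v (od i) + v (ev i) * u (od i)))
  Qf-isQuadratic = sum-isQuadratic (λ i → product-isQuadratic (ev i) (od i))

  QForm4-isQuadratic : ∀ a →
    IsQuadratic (QForm4 a) (λ u v → sumF (λ i → sumF (λ j → a i j * (u i * v j + v i * u j))))
  QForm4-isQuadratic a =
    sum-isQuadratic (λ i → sum-isQuadratic (λ j → weighted-isQuadratic (a i j) i j))

  module QuadraticForm {n} {Q : V n → Carrier} {B : V n → V n → Carrier}
                       (isQ : IsQuadratic Q B) where
    open IsQuadratic isQ public using (Q-cong)
    open IsQuadratic isQ using (Q-scale; Q-expand; B-addˡ; B-scaleˡ)

    polar≈B : ∀ u v → Polar Q u v ≈ B u v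
    polar≈B u v = trans (+-congʳ (+-congʳ (Q-expand u v))) (cancel-sum (Q u) (Q v) (B u v))

    Q-add : ∀ u v → Q (u +ᵥ v) ≈ (Q u + Q v) + Polar Q u v
    Q-add u v = trans (Q-expand u v) (+-congˡ (sym (polar≈B u v)))

    Q-zero : Q 0ᵥ ≈ 0#
    Q-zero = begin
      Q 0ᵥ                  ≈⟨ Q-cong (λ _ → sym (zeroˡ 0#)) ⟩
      Q (0# ·ᵥ 0ᵥ)          ≈⟨ Q-scale 0# 0ᵥ ⟩
      (0# * 0#) * Q 0ᵥ      ≈⟨ *-congʳ (zeroˡ 0#) ⟩
      0# * Q 0ᵥ             ≈⟨ zeroˡ _ ⟩
      0#                    ∎

    polar-sym : ∀ u v → Polar Q u v ≈ Polar Q v u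
    polar-sym u v = trans (+-congʳ (+-congʳ (Q-cong (λ i → +-comm (u i) (v i))))) (swap _ _ _)
      where
      swap : ∀ x y z → (x + y) + z ≈ (x + z) + y
      swap = solve 3 (λ x y z → (x :+ y) :+ z := (x :+ z) :+ y) refl

    polar-congˡ : ∀ {u u'} w → u ≈ᵥ u' → Polar Q u w ≈ Polar Q u' w
    polar-congˡ w e = +-congʳ (+-cong (Q-cong (λ i → +-congʳ (e i))) (-‿cong (Q-cong e)))

    polar-congʳ : ∀ u {w w'} → w ≈ᵥ w' → Polar Q u w ≈ Polar Q u w'
    polar-congʳ u {w} {w'} e = trans (polar-sym u w) (trans (polar-congˡ u e) (polar-sym w' u))

    polar-addˡ : ∀ u v w → Polar Q (u +ᵥ v) w ≈ Polar Q u w + Polar Q v w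
    polar-addˡ u v w = trans (polar≈B _ w)
      (trans (B-addˡ u v w) (sym (+-cong (polar≈B u w) (polar≈B v w))))

    polar-scaleˡ : ∀ a u w → Polar Q (a ·ᵥ u) w ≈ a * Polar Q u w
    polar-scaleˡ a u w = trans (polar≈B _ w) (trans (B-scaleˡ a u w) (*-congˡ (sym (polar≈B u w))))

    polar-addʳ : ∀ w u v → Polar Q w (u +ᵥ v) ≈ Polar Q w u + Polar Q w v
    polar-addʳ w u v = trans (polar-sym w _)
      (trans (polar-addˡ u v w) (+-cong (polar-sym u w) (polar-sym v w)))

    polar-scaleʳ : ∀ w a u → Polar Q w (a ·ᵥ u) ≈ a * Polar Q w u
    polar-scaleʳ w a u = trans (polar-sym w _) (trans (polar-scaleˡ a u w) (*-congˡ (polar-sym u w)))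

    polar-linˡ : ∀ {k} (c : V k) (b : Fin k → V n) w →
                 Polar Q (lin c b) w ≈ sumF (λ i → c i * Polar Q (b i) w)
    polar-linˡ {ℕ.zero} c b w = begin
      Polar Q (lin c b) w   ≈⟨ polar-congˡ w (λ _ → sym (zeroˡ 0#)) ⟩
      Polar Q (0# ·ᵥ 0ᵥ) w  ≈⟨ polar-scaleˡ 0# 0ᵥ w ⟩
      0# * Polar Q 0ᵥ w     ≈⟨ zeroˡ _ ⟩
      0#                    ∎
    polar-linˡ {ℕ.suc k} c b w =
      trans (polar-addˡ (head c ·ᵥ b zero) (lin (tail c) (tail b)) w)
            (+-cong (polar-scaleˡ (head c) (b zero) w) (polar-linˡ (tail c) (tail b) w))

    perp-lin : ∀ {k} (c : V k) (b : Fin k → V n) w →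
               (∀ i → Polar Q (b i) w ≈ 0#) → Polar Q (lin c b) w ≈ 0#
    perp-lin c b w b⊥w = trans (polar-linˡ c b w) (sumF-zero (λ i → trans (*-congˡ (b⊥w i)) (zeroʳ _)))

    polar-singular : ∀ {u v} → Q (u +ᵥ v) ≈ 0# → Q u ≈ 0# → Q v ≈ 0# → Polar Q u v ≈ 0#
    polar-singular Qu+v Qu Qv = trans (+-cong (+-cong Qu+v (-‿cong Qu)) (-‿cong Qv)) zero-minus

    polar-self : ∀ {u} → Q u ≈ 0# → Polar Q u u ≈ 0#
    polar-self {u} Qu = polar-singular Q2u Qu Qu
      where
      Q2u : Q (u +ᵥ u) ≈ 0#
      Q2u = begin
        Q (u +ᵥ u)                       ≈⟨ Q-cong (λ i → sym (trans (distribʳ (u i) 1# 1#)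
                                                     (+-cong (*-identityˡ (u i)) (*-identityˡ (u i))))) ⟩
        Q ((1# + 1#) ·ᵥ u)               ≈⟨ Q-scale (1# + 1#) u ⟩
        ((1# + 1#) * (1# + 1#)) * Q u    ≈⟨ *-congˡ Qu ⟩
        ((1# + 1#) * (1# + 1#)) * 0#     ≈⟨ zeroʳ _ ⟩
        0#                               ∎

    totallySingular : ∀ {k} (b : Fin k → V n) → (∀ i → Q (b i) ≈ 0#) →
                      (∀ i j → Polar Q (b i) (b j) ≈ 0#) → ∀ c → Q (lin c b) ≈ 0#
    totallySingular {ℕ.zero} b _ _ c = trans (Q-cong (λ _ → refl)) Q-zero
    totallySingular {ℕ.suc k} b singular perp c = begin
      Q (lin c b)                               ≈⟨ Q-add (head c ·ᵥ b zero) L ⟩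
      (Q (head c ·ᵥ b zero) + Q L) + Polar Q (head c ·ᵥ b zero) L
        ≈⟨ +-cong (+-cong Qhead Qtail) Perp ⟩
      (0# + 0#) + 0#                            ≈⟨ trans (+-identityʳ _) (+-identityʳ _) ⟩
      0#                                        ∎
      where
      L = lin (tail c) (tail b)
      Qhead : Q (head c ·ᵥ b zero) ≈ 0#
      Qhead = trans (Q-scale _ _) (trans (*-congˡ (singular zero)) (zeroʳ _))
      Qtail : Q L ≈ 0#
      Qtail = totallySingular (tail b) (λ i → singular (suc i)) (λ i j → perp (suc i) (suc j)) (tail c)
      Perp : Polar Q (head c ·ᵥ b zero) L ≈ 0#
      Perp = trans (polar-scaleˡ _ _ L) (trans (*-congˡ (trans (polar-sym _ L)
               (perp-lin (tail c) (tail b) (b zero) (λ i → perp (suc i) zero)))) (zeroʳ _))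

  open QuadraticForm Qf-isQuadratic
  module Q4 (a : Fin 4 → Fin 4 → Carrier) = QuadraticForm (QForm4-isQuadratic a)

  ts-singular : ∀ {k} {b : Fin k → V 10} → TotSingular b → ∀ {u} → InSpan b u → Qf u ≈ 0#
  ts-singular ts (c , u≈) = trans (Q-cong u≈) (ts c)

  ts-perp : ∀ {k} {b : Fin k → V 10} → TotSingular b → ∀ {u v} →
            InSpan b u → InSpan b v → Bf u v ≈ 0#
  ts-perp {b = b} ts {u} {v} hu hv =
    polar-singular {u} {v} (ts-singular ts (span-+ {b = b} hu hv))
                           (ts-singular ts hu) (ts-singular ts hv)

  ts-sub : ∀ {k m} {b : Fin k → V 10} {b' : Fin m → V 10} →
           TotSingular b' → (∀ i → InSpan b' (b i)) → TotSingular b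
  ts-sub {b = b} {b'} ts b⊆b' c = ts-singular ts (span-sub {b = b} {b' = b'} b⊆b' (c , λ _ → refl))

  ts-extend : ∀ {k} {b : Fin k → V 10} {v} → TotSingular b → Qf v ≈ 0# →
              (∀ i → Bf v (b i) ≈ 0#) → TotSingular (v ∷ b)
  ts-extend {b = b} {v} ts Qv v⊥b = totallySingular (v ∷ b) singular perp
    where
    singular : ∀ i → Qf ((v ∷ b) i) ≈ 0#
    singular zero    = Qv
    singular (suc i) = ts-singular ts (span-gen b i)
    perp : ∀ i j → Bf ((v ∷ b) i) ((v ∷ b) j) ≈ 0#
    perp zero    zero    = polar-self {v} Qv
    perp zero    (suc j) = v⊥b j
    perp (suc i) zero    = trans (polar-sym (b i) v) (v⊥b i)
    perp (suc i) (suc j) = ts-perp ts (span-gen b i) (span-gen b j)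

  -- Otherwise
  -- let O₀ be the ovoid point of the generator and τ a solid of it through
  -- O₀ (hyperplaneThrough): ⟨P, τ⟩ is again a generator, so O₀ ∝ P.
  ovoidPointInGenerator : ∀ {O} → Ovoid O → ∀ {R} {σ : Fin 4 → V 10} →
    LinIndep σ → ¬ InSpan σ R → TotSingular (R ∷ σ) →
    ∀ {P} → O P → (∀ i → Bf P ((R ∷ σ) i) ≈ 0#) → ¬ ¬ InSpan (R ∷ σ) P
  ovoidPointInGenerator {O} (pointSet , meetsOnce) {R} {σ} indσ R∉σ tsG {P} OP P⊥G P∉G =
    let (O₀ , OO₀ , O₀∈G)       = proj₁ (meetsOnce G genG)
        (τ , indτ , τ⊆G , O₀∈τ) = hyperplaneThrough {R = R} {σ = σ} indσ R∉σ O₀∈G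
    in P∉G (proportional-span {b = G} (proportional-sym (meetsP OO₀ τ indτ τ⊆G O₀∈τ)) O₀∈G)
    where
    G = R ∷ σ
    genG : Generator G
    genG = indep-cons {b = σ} indσ R∉σ , tsG
    -- A solid τ of G through an ovoid point O₀ spans with P a generator
    -- (it lies in the totally singular ⟨P, G⟩), so O₀ ∝ P.
    meetsP : ∀ {O₀} → O O₀ → (τ : Fin 4 → V 10) → LinIndep τ → (∀ i → InSpan G (τ i)) →
             InSpan τ O₀ → Proportional O₀ P
    meetsP {O₀} OO₀ τ indτ τ⊆G O₀∈τ =
      proj₂ (meetsOnce H genH) O₀ P OO₀ OP
        (span-sub {b = τ} {b' = H} (λ i → span-gen H (suc i)) O₀∈τ) (span-gen H zero)
      where
      H = P ∷ τ
      H⊆PG : ∀ i → InSpan (P ∷ G) (H i)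
      H⊆PG zero    = span-gen (P ∷ G) zero
      H⊆PG (suc i) = span-sub {b = G} {b' = P ∷ G} (λ j → span-gen (P ∷ G) (suc j)) (τ⊆G i)
      tsPG : TotSingular (P ∷ G)
      tsPG = ts-extend {b = G} {v = P} tsG (proj₂ (proj₂ pointSet P OP)) P⊥G
      genH : Generator H
      genH = indep-cons {b = τ} indτ (λ P∈τ → P∉G (span-sub {b = τ} {b' = G} τ⊆G P∈τ)) ,
             ts-sub {b = H} {b' = P ∷ G} tsPG H⊆PG

  perp-basis : ∀ {k} w (b : Fin k → V 10) → (∀ c → Bf w (lin c b) ≈ 0#) → ∀ i → Bf w (b i) ≈ 0#
  perp-basis w b w⊥ i = trans (polar-congʳ w (proj₂ (span-gen b i))) (w⊥ (proj₁ (span-gen b i)))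

  -- For distinct ovoid points P₁, P₂, a solid σ of Q⁺₇ = P₁^⊥ ∩ P₂^⊥ ∩ Q⁺(9,q)
  -- lies in no generator of Q⁺(9,q) inside P₁^⊥ ∩ P₂^⊥: by
  -- ovoidPointInGenerator such a generator ⟨R, σ⟩ would contain P₁ and P₂.
  solidInNoGenerator : ∀ {O} → Ovoid O → ∀ {P₁ P₂} → O P₁ → O P₂ → ¬ Proportional P₁ P₂ →
    ∀ {σ} → SolidOfQ7 P₁ P₂ σ → ∀ {R} → Qf R ≈ 0# → Bf P₁ R ≈ 0# → Bf P₂ R ≈ 0# →
    ¬ InSpan σ R → ¬ (∀ d → Bf (lin d σ) R ≈ 0#)
  solidInNoGenerator {O} ovoid {P₁} {P₂} OP₁ OP₂ P₁≁P₂ {σ} (indσ , tsσ , σ⊥P) {R} QR P₁⊥R P₂⊥R R∉σ σ⊥R =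
    inG {P₁} OP₁ (P⊥G {P₁} P₁⊥R (λ c → proj₁ (σ⊥P c))) (λ P₁∈G →
    inG {P₂} OP₂ (P⊥G {P₂} P₂⊥R (λ c → proj₂ (σ⊥P c))) (λ P₂∈G →
    P₁≁P₂ (proj₂ (proj₂ ovoid G genG) P₁ P₂ OP₁ OP₂ P₁∈G P₂∈G)))
    where
    G = R ∷ σ
    tsG : TotSingular G
    tsG = ts-extend {b = σ} {v = R} tsσ QR
            (perp-basis R σ (λ c → trans (polar-sym R (lin c σ)) (σ⊥R c)))
    genG : Generator G
    genG = indep-cons {b = σ} indσ R∉σ , tsG
    inG : ∀ {P} → O P → (∀ i → Bf P (G i) ≈ 0#) → ¬ ¬ InSpan G P
    inG = ovoidPointInGenerator ovoid {R} {σ} indσ R∉σ tsG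
    P⊥G : ∀ {P} → Bf P R ≈ 0# → (∀ c → Bf P (lin c σ) ≈ 0#) → ∀ i → Bf P (G i) ≈ 0#
    P⊥G     P⊥R _ zero    = P⊥R
    P⊥G {P} _ P⊥σ (suc i) = perp-basis P σ P⊥σ i

  record IsLinear {k} (f : V k → Carrier) : Set where
    field
      additive    : ∀ u v → f (u +ᵥ v) ≈ f u + f v
      homogeneous : ∀ a u → f (a ·ᵥ u) ≈ a * f u
  open IsLinear

  -- If g y ≉ 0 and f vanishes on the kernel of g, then f = (g / g y) · f y:
  -- apply f to d - (g d / g y) · y, which lies in the kernel of g.
  kernel⇒proportional : ∀ {k} {f g : V k → Carrier} → IsLinear f → IsLinear g →
    ∀ {y} (gy≉0 : g y ≉ 0#) → (∀ d → g d ≈ 0# → f d ≈ 0#) →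
    ∀ d → f d ≈ (g d * inv (g y) gy≉0) * f y
  kernel⇒proportional {f = f} {g} linf ling {y} gy≉0 ker d =
    balance μ (f y) (trans (sym f-d') (ker d' g-d'))
    where
    μ = g d * inv (g y) gy≉0
    d' = d +ᵥ ((- μ) ·ᵥ y)
    f-d' : f d' ≈ f d + (- μ) * f y
    f-d' = trans (additive linf d _) (+-congˡ (homogeneous linf (- μ) y))
    g-d' : g d' ≈ 0#
    g-d' = trans (additive ling d _) (trans (+-congˡ (homogeneous ling (- μ) y))
             (balance⁻¹ μ (g y) (sym (divide-cancel (g d) (g y) gy≉0))))

  kernel⇒dependent : ∀ {k} {f₁ f₂ g : V k → Carrier} → IsLinear f₁ → IsLinear f₂ → IsLinear g →
    ∀ {y} → g y ≉ 0# → (∀ d → g d ≈ 0# → f₁ d ≈ 0#) → (∀ d → g d ≈ 0# → f₂ d ≈ 0#) →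
    ∀ d → f₂ y * f₁ d ≈ f₁ y * f₂ d
  kernel⇒dependent {f₁ = f₁} {f₂} {g} lin₁ lin₂ ling {y} gy≉0 ker₁ ker₂ d = begin
    f₂ y * f₁ d          ≈⟨ *-congˡ (kernel⇒proportional lin₁ ling gy≉0 ker₁ d) ⟩
    f₂ y * (μ * f₁ y)    ≈⟨ exchange (f₂ y) μ (f₁ y) ⟩
    f₁ y * (μ * f₂ y)    ≈⟨ *-congˡ (kernel⇒proportional lin₂ ling gy≉0 ker₂ d) ⟨
    f₁ y * f₂ d          ∎
    where
    μ = g d * inv (g y) gy≉0
    exchange : ∀ a m b → a * (m * b) ≈ b * (m * a)
    exchange = solve 3 (λ a m b → a :* (m :* b) := b :* (m :* a)) refl

  polar4-isLinear : ∀ a x → IsLinear (BForm4 a x)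
  polar4-isLinear a x = record { additive = Q4.polar-addʳ a x ; homogeneous = Q4.polar-scaleʳ a x }

  coordinate-isLinear : ∀ {k} (σ : Fin k → V 10) R → IsLinear (λ d → Bf (lin d σ) R)
  coordinate-isLinear σ R = record
    { additive    = λ u v → trans (polar-congˡ R (lin-+ u v σ)) (polar-addˡ (lin u σ) (lin v σ) R)
    ; homogeneous = λ a u → trans (polar-congˡ R (lin-· a u σ)) (polar-scaleˡ a (lin u σ) R)
    }

  -- An elliptic quadric has no two non-proportional conjugate points: they
  -- would span a totally singular line.
  elliptic-conjugate : ∀ {a} → Elliptic a → ∀ {x y} → NonzeroV x → NonzeroV y →
    QForm4 a x ≈ 0# → QForm4 a y ≈ 0# → BForm4 a x y ≈ 0# → ¬ ¬ Proportional x y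
  elliptic-conjugate {a} (_ , _ , noLine) {x} {y} x≠0 y≠0 Qx Qy Bxy x≁y =
    noLine (x ∷ y ∷ []) (indep-pair x≠0 y≠0 x≁y) (Q4.totallySingular a (x ∷ y ∷ []) singular perp)
    where
    singular : ∀ i → QForm4 a ((x ∷ y ∷ []) i) ≈ 0#
    singular zero       = Qx
    singular (suc zero) = Qy
    perp : ∀ i j → BForm4 a ((x ∷ y ∷ []) i) ((x ∷ y ∷ []) j) ≈ 0#
    perp zero       zero       = Q4.polar-self a {x} Qx
    perp zero       (suc zero) = Bxy
    perp (suc zero) zero       = trans (Q4.polar-sym a y x) Bxy
    perp (suc zero) (suc zero) = Q4.polar-self a {y} Qy

  nonsingular-witness : ∀ {a} → Elliptic a → ∀ {x} → NonzeroV x → ¬ ¬ ∃ λ d → BForm4 a x d ≉ 0#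
  nonsingular-witness (nondegenerate , _) x≠0 noWitness =
    x≠0 (nondegenerate _ (λ d → stable (λ xd≉0 → noWitness (d , xd≉0))))

  -- If P = p₀ R + p₁ X lies outside a totally singular span σ containing X,
  -- then p₀ ≉ 0, so P ⟂ Y for some Y ∈ σ forces R ⟂ Y.
  outside-perp : ∀ {k} {σ : Fin k → V 10} → TotSingular σ → ∀ {R X P Y} →
    InSpan σ X → InSpan σ Y → ¬ InSpan σ P → InSpan (pair R X) P → Bf P Y ≈ 0# → Bf R Y ≈ 0#
  outside-perp {σ = σ} ts {R} {X} {P} {Y} X∈σ Y∈σ P∉σ (p , P≈) P⊥Y = cancelˡ p₀≉0 (begin
    head p * Bf R Y                                  ≈⟨ +-identityʳ _ ⟨
    head p * Bf R Y + 0#                             ≈⟨ +-congˡ X⊥Y ⟨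
    head p * Bf R Y + (p (suc zero) * Bf X Y + 0#)   ≈⟨ polar-linˡ p (pair R X) Y ⟨
    Bf (lin p (pair R X)) Y                          ≈⟨ polar-congˡ Y P≈ ⟨
    Bf P Y                                           ≈⟨ P⊥Y ⟩
    0#                                               ∎)
    where
    X⊥Y : p (suc zero) * Bf X Y + 0# ≈ 0#
    X⊥Y = trans (+-identityʳ _) (trans (*-congˡ (ts-perp ts X∈σ Y∈σ)) (zeroʳ _))
    p₀≉0 : head p ≉ 0#
    p₀≉0 p₀≈0 = P∉σ (span-cong {b = σ} (λ j → trans (P≈ j)
      (trans (+-cong (trans (*-congʳ p₀≈0) (zeroˡ _)) (+-identityʳ _)) (+-identityˡ _)))
      (span-· (p (suc zero)) X∈σ))

  solid-perp : ∀ {P₁ P₂ σ} → SolidOfQ7 P₁ P₂ σ → ∀ {u} → InSpan σ u → Bf P₁ u ≈ 0# × Bf P₂ u ≈ 0#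
  solid-perp {P₁} {P₂} (_ , _ , σ⊥P) (c , u≈) =
    trans (polar-congʳ P₁ u≈) (proj₁ (σ⊥P c)) , trans (polar-congʳ P₂ u≈) (proj₂ (σ⊥P c))

  module Configuration {O} (ovoid : Ovoid O) (P₁ P₂ : V 10) (OP₁ : O P₁) (OP₂ : O P₂)
    (P₁≁P₂ : ¬ Proportional P₁ P₂) (σ₁ σ₂ : Fin 4 → V 10) (solid₁ : SolidOfQ7 P₁ P₂ σ₁)
    (solid₂ : SolidOfQ7 P₁ P₂ σ₂) (disjoint : ∀ v → InSpan σ₁ v → InSpan σ₂ v → v ≈ᵥ 0ᵥ)
    (a : Fin 4 → Fin 4 → Carrier) where

    -- R is the point π^⊥ ∩ σ₂ for the tangent plane π = x^⊥ of σ₁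
    -- (x given in coordinates of σ₁).
    IsPole : V 4 → V 10 → Set
    IsPole x R = NonzeroV R × InSpan σ₂ R × (∀ d → BForm4 a x d ≈ 0# → Bf (lin d σ₁) R ≈ 0#)

    noPointPerpendicular : ∀ {R} → NonzeroV R → InSpan σ₂ R → ¬ (∀ d → Bf (lin d σ₁) R ≈ 0#)
    noPointPerpendicular {R} R≠0 R∈σ₂ =
      solidInNoGenerator ovoid OP₁ OP₂ P₁≁P₂ {σ₁} solid₁ {R}
        (ts-singular {b = σ₂} (proj₁ (proj₂ solid₂)) R∈σ₂) (proj₁ R⊥P) (proj₂ R⊥P)
        (λ R∈σ₁ → R≠0 (disjoint R R∈σ₁ R∈σ₂))
      where
      R⊥P : Bf P₁ R ≈ 0# × Bf P₂ R ≈ 0#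
      R⊥P = solid-perp {P₁} {P₂} {σ₂} solid₂ {R} R∈σ₂

    -- The functional of a pole is a nonzero multiple of the tangent
    -- functional, so a pole is perpendicular to no point off the tangent plane.
    pole-nonperp : ∀ {x R} → IsPole x R → ∀ {y} → BForm4 a x y ≉ 0# → Bf (lin y σ₁) R ≉ 0#
    pole-nonperp {x} {R} (R≠0 , R∈σ₂ , tangent) {y} xy≉0 y⊥R =
      noPointPerpendicular R≠0 R∈σ₂ λ d →
      trans (kernel⇒proportional {f = λ d → Bf (lin d σ₁) R} {g = BForm4 a x}
                (coordinate-isLinear σ₁ R) (polar4-isLinear a x) {y} xy≉0 tangent d)
            (trans (*-congˡ y⊥R) (zeroʳ (BForm4 a x d * inv (BForm4 a x y) xy≉0)))

    -- Two poles of the same tangent plane are proportional: the combination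
    -- ρ₂ R₁ - ρ₁ R₂ (ρᵢ = B(lin d σ₁, Rᵢ)) is perpendicular to σ₁, hence zero.
    poles-proportional : ∀ {x R₁ R₂} → IsPole x R₁ → IsPole x R₂ →
                         ∀ {d} → BForm4 a x d ≉ 0# → Proportional R₁ R₂
    poles-proportional {x} {R₁} {R₂} pole₁@(_ , R₁∈σ₂ , tangent₁) pole₂@(_ , R₂∈σ₂ , tangent₂)
                       {d} xd≉0 =
      inv ρ₂ ρ₂≉0 * ρ₁ , *-nonzero (inv-nonzero ρ₂ ρ₂≉0) (pole-nonperp {x} {R₁} pole₁ {d} xd≉0) ,
      λ j → trans (divideˡ ρ₂≉0 (balance ρ₁ (R₂ j) (R'≈0 j)))
                  (sym (*-assoc (inv ρ₂ ρ₂≉0) ρ₁ (R₂ j)))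
      where
      ρ₁ = Bf (lin d σ₁) R₁
      ρ₂ = Bf (lin d σ₁) R₂
      ρ₂≉0 : ρ₂ ≉ 0#
      ρ₂≉0 = pole-nonperp {x} {R₂} pole₂ {d} xd≉0
      R' = (ρ₂ ·ᵥ R₁) +ᵥ ((- ρ₁) ·ᵥ R₂)
      R'∈σ₂ : InSpan σ₂ R'
      R'∈σ₂ = span-+ {b = σ₂} (span-· {b = σ₂} ρ₂ R₁∈σ₂) (span-· {b = σ₂} (- ρ₁) R₂∈σ₂)
      R'⊥σ₁ : ∀ e → Bf (lin e σ₁) R' ≈ 0#
      R'⊥σ₁ e = begin
        Bf E R'                                   ≈⟨ polar-addʳ E (ρ₂ ·ᵥ R₁) ((- ρ₁) ·ᵥ R₂) ⟩
        Bf E (ρ₂ ·ᵥ R₁) + Bf E ((- ρ₁) ·ᵥ R₂)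
          ≈⟨ +-cong (polar-scaleʳ E ρ₂ R₁) (polar-scaleʳ E (- ρ₁) R₂) ⟩
        ρ₂ * Bf E R₁ + (- ρ₁) * Bf E R₂           ≈⟨ balance⁻¹ ρ₁ (Bf E R₂) dependent ⟩
        0#                                        ∎
        where
        E = lin e σ₁
        dependent : ρ₂ * Bf E R₁ ≈ ρ₁ * Bf E R₂
        dependent = kernel⇒dependent {f₁ = λ e → Bf (lin e σ₁) R₁} {f₂ = λ e → Bf (lin e σ₁) R₂}
                      {g = BForm4 a x} (coordinate-isLinear σ₁ R₁) (coordinate-isLinear σ₁ R₂)
                      (polar4-isLinear a x) {d} xd≉0 tangent₁ tangent₂ e
      R'≈0 : R' ≈ᵥ 0ᵥ
      R'≈0 j = stable (λ R'ⱼ≉0 →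
        noPointPerpendicular {R'} (λ R'≈0 → R'ⱼ≉0 (R'≈0 j)) R'∈σ₂ R'⊥σ₁)

    pole-proportional : ∀ {x y R} → Proportional x y → IsPole y R → IsPole x R
    pole-proportional {x} {y} (λ₀ , λ₀≉0 , x≈) (R≠0 , R∈σ₂ , tangent) = R≠0 , R∈σ₂ , λ d x⊥d →
      tangent d (cancelˡ λ₀≉0 (trans (sym (Q4.polar-scaleˡ a λ₀ y d))
                                     (trans (Q4.polar-congˡ a d (≈ᵥ-sym x≈)) x⊥d)))

    sameTangent⇒sameLine : Elliptic a → ∀ {x₁ x₂ R₁ R₂} → NonzeroV x₁ →
      IsPole x₁ R₁ → IsPole x₂ R₂ → Proportional x₁ x₂ →
      ¬ ¬ SameSpan (pair R₁ (lin x₁ σ₁)) (pair R₂ (lin x₂ σ₁))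
    sameTangent⇒sameLine elliptic {x₁} {x₂} {R₁} {R₂} x₁≠0 pole₁ pole₂ x₁∝x₂ differentLines =
      nonsingular-witness {a} elliptic {x₁} x₁≠0 (λ { (d , x₁d≉0) → differentLines (sameSpan-pair
        (poles-proportional {x₁} {R₁} {R₂} pole₁ (pole-proportional {x₁} {x₂} {R₂} x₁∝x₂ pole₂)
                            {d} x₁d≉0)
        (proportional-lin {x = x₁} {x₂} σ₁ x₁∝x₂)) })

    perpendicular⇒conjugate : ∀ {x₁ x₂ R₁} → IsPole x₁ R₁ → Bf R₁ (lin x₂ σ₁) ≈ 0# →
                              BForm4 a x₁ x₂ ≈ 0#
    perpendicular⇒conjugate {x₁} {x₂} {R₁} pole₁ R₁⊥X₂ = stable (λ x₁x₂≉0 →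
      pole-nonperp {x₁} {R₁} pole₁ {x₂} x₁x₂≉0 (trans (polar-sym (lin x₂ σ₁) R₁) R₁⊥X₂))

lemma4p2 : (q : ℕ) (F : FiniteField q) → 2 ∣ q →
    let open FiniteField F
        open Geometry F
    in
    (O : V 10 → Set) → Ovoid O →
    (P₁ P₂ : V 10) → O P₁ → O P₂ → ¬ Proportional P₁ P₂ →
    (σ₁ : Fin 4 → V 10) → SolidOfQ7 P₁ P₂ σ₁ →
    (a : Fin 4 → Fin 4 → Carrier) → Elliptic a →
    (σ₂ : Fin 4 → V 10) → SolidOfQ7 P₁ P₂ σ₂ →
    (∀ v → InSpan σ₁ v → InSpan σ₂ v → v ≈ᵥ 0ᵥ) →
    (x₁ x₂ : V 4) →
    NonzeroV x₁ → QForm4 a x₁ ≈ 0# →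
    NonzeroV x₂ → QForm4 a x₂ ≈ 0# →
    (R₁ R₂ : V 10) →
    NonzeroV R₁ → InSpan σ₂ R₁ →
    (∀ d → BForm4 a x₁ d ≈ 0# → Bf (lin d σ₁) R₁ ≈ 0#) →
    NonzeroV R₂ → InSpan σ₂ R₂ →
    (∀ d → BForm4 a x₂ d ≈ 0# → Bf (lin d σ₁) R₂ ≈ 0#) →
    ¬ SameSpan (pair R₁ (lin x₁ σ₁)) (pair R₂ (lin x₂ σ₁)) →
    (P Q : V 10) →
    NonzeroV P → InSpan (pair R₁ (lin x₁ σ₁)) P →
    NonzeroV Q → InSpan (pair R₂ (lin x₂ σ₁)) Q →
    Collinear P Q → ¬ InSpan σ₁ P → ¬ InSpan σ₁ Q →
    ¬ (∀ v → InSpan (pair R₂ (lin x₂ σ₁)) v → Bf P v ≈ 0#)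
lemma4p2 _ F _ _ ovoid P₁ P₂ OP₁ OP₂ P₁≁P₂ σ₁ solid₁ a elliptic σ₂ solid₂ disjoint
         x₁ x₂ x₁≠0 Qx₁ x₂≠0 Qx₂ R₁ R₂ R₁≠0 R₁∈σ₂ tangent₁ R₂≠0 R₂∈σ₂ tangent₂ l₁≠l₂
         P _ _ P∈l₁ _ _ _ P∉σ₁ _ P⊥l₂ =
  elliptic-conjugate {a} elliptic {x₁} {x₂} x₁≠0 x₂≠0 Qx₁ Qx₂ x₁⊥x₂ (λ x₁∝x₂ →
    sameTangent⇒sameLine elliptic {x₁} {x₂} {R₁} {R₂} x₁≠0 pole₁ pole₂ x₁∝x₂ l₁≠l₂)
  where
  open FiniteField F hiding (zero)
  open Geometry F
  open OvoidGeometry F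
  open Configuration ovoid P₁ P₂ OP₁ OP₂ P₁≁P₂ σ₁ σ₂ solid₁ solid₂ disjoint a
  pole₁ : IsPole x₁ R₁
  pole₁ = R₁≠0 , R₁∈σ₂ , tangent₁
  pole₂ : IsPole x₂ R₂
  pole₂ = R₂≠0 , R₂∈σ₂ , tangent₂
  -- P ∈ l₁ \ σ₁ is perpendicular to the point X₂ = lin x₂ σ₁ of l₂, hence so is R₁ …
  R₁⊥X₂ : Bf R₁ (lin x₂ σ₁) ≈ 0#
  R₁⊥X₂ = outside-perp {σ = σ₁} (proj₁ (proj₂ solid₁)) {R₁} {lin x₁ σ₁} {P} {lin x₂ σ₁}
            (x₁ , λ _ → refl) (x₂ , λ _ → refl) P∉σ₁ P∈l₁
            (P⊥l₂ (lin x₂ σ₁) (span-gen (pair R₂ (lin x₂ σ₁)) (suc zero)))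
  -- … so x₂ lies on the tangent plane at x₁.
  x₁⊥x₂ : BForm4 a x₁ x₂ ≈ 0#
  x₁⊥x₂ = perpendicular⇒conjugate {x₁} {x₂} {R₁} pole₁ R₁⊥X₂
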